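{- If $r$ is a balanced rotor type, then $UD(r)$ is palindromic only if $r$ starts and ends with the same term, i.e. $r^{(1)}=r^{(|r|)}$.
   Context: A rotor type is an infinite periodic sequence $r=(r^{(1)},r^{(2)},\dots)$ of states, with (fundamental) period $|r|$; it is palindromic if $r^{(k)}=r^{(|r|+1-k)}$ for all $k$. A two-state rotor type is written over $\{1,2\}$ with the convention $r^{(1)}=1$; it is balanced if $1$ and $2$ occur equally often in a period. Rotor-router dynamics: at each non-target vertex $v$ there is a periodic sequence $e_v^{(1)},e_v^{(2)},\dots$ of out-edges; a particle starts at the source, on its $n$-th visit to a non-target vertex $v$ leaves along $e_v^{(n)}$, and whenever it reaches a target it is returned to the source; the hitting sequence is the (periodic) sequence of targets reached. The compressor $UD$ for $r$ has non-target vertices $1$ (source), $2,3$ and targets $4,5$; on the $n$-th departure: from vertex $1$ the particle goes to vertex $2$ if $r^{(n)}=1$ and to vertex $3$ if $r^{(n)}=2$; from vertex $2$ it goes to vertex $1$ if $r^{(n)}=1$ and to target $4$ if $r^{(n)}=2$; from vertex $3$ it goes to target $5$ if $r^{(n)}=1$ and to vertex $1$ if $r^{(n)}=2$. $UD(r)$ is its hitting sequence, viewed as a rotor type (with $4$ written as $1$ and $5$ as $2$). -}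

module Defs where

open import Data.Nat using (ℕ; zero; suc; _+_; _∸_; _≤_; _<_)
open import Data.Product using (_×_; ∃)
open import Data.Maybe using (Maybe; just; nothing)
open import Relation.Binary.PropositionalEquality using (_≡_)

data S : Set where
  one two : S

-- Sequences are 0-indexed: s k is the (k+1)-th term s^(k+1).

IsPeriod : (ℕ → S) → ℕ → Set
IsPeriod s p = (0 < p) × (∀ k → s (k + p) ≡ s k)

FundPeriod : (ℕ → S) → ℕ → Set
FundPeriod s p = IsPeriod s p × (∀ q → IsPeriod s q → p ≤ q)

Palindromic : (ℕ → S) → ℕ → Set
Palindromic s p = ∀ k → k < p → s k ≡ s (p ∸ suc k)

count : S → (ℕ → S) → ℕ → ℕ
count x s zero = 0
count one s (suc n) with s n
... | one = suc (count one s n)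
... | two = count one s n
count two s (suc n) with s n
... | one = count two s n
... | two = suc (count two s n)

Balanced : (ℕ → S) → ℕ → Set
Balanced s p = count one s p ≡ count two s p

-- Vertices of the compressor UD: 1 (source), 2, 3 non-targets; 4, 5 targets.
data V : Set where
  v1 v2 v3 v4 v5 : V

-- configuration: current position and number of departures so far from 1, 2, 3
record Config : Set where
  constructor cfg
  field
    pos : V
    c1 c2 c3 : ℕ

initCfg : Config
initCfg = cfg v1 0 0 0

-- On the n-th departure from a non-target vertex
-- (n = c + 1 where c departures already happened) the rotor state r^(n) = r c is used.
step : (ℕ → S) → Config → Config
step r (cfg v1 a b c) with r a
... | one = cfg v2 (suc a) b c
... | two = cfg v3 (suc a) b c
step r (cfg v2 a b c) with r b
... | one = cfg v1 a (suc b) c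
... | two = cfg v4 a (suc b) c
step r (cfg v3 a b c) with r c
... | one = cfg v5 a b (suc c)
... | two = cfg v1 a b (suc c)
step r (cfg v4 a b c) = cfg v1 a b c
step r (cfg v5 a b c) = cfg v1 a b c

run : (ℕ → S) → ℕ → Config
run r zero = initCfg
run r (suc t) = step r (run r t)

label : V → Maybe S
label v4 = just one
label v5 = just two
label _  = nothing

hits : (ℕ → S) → ℕ → ℕ
hits r zero = 0
hits r (suc t) with label (Config.pos (run r t))
... | just _  = suc (hits r t)
... | nothing = hits r t

IsHittingSeq : (ℕ → S) → (ℕ → S) → Set
IsHittingSeq r h =
  ∀ k → ∃ λ t → (label (Config.pos (run r t)) ≡ just (h k)) × (hits r t ≡ k)

-- Trip a (the (a+1)-th departure from the source) reads r^(a+1) at vertex 1 and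
-- then, at vertex 2 resp. 3, the rotor entry indexed by the number ones a resp.
-- twos a of earlier trips through that vertex, i.e. by the number of 1s resp. 2s
-- among r^(1), …, r^(a).  So the hits before trip a number
-- twos (ones a) + ones (twos a).  If r is balanced of period p, shifting by 2p
-- trips shifts both counts by p, so UD(r) has period p.  If r^(1) = 1 but
-- r^(p) = 2, the first trip through vertex 3 reads r^(1) = 1 and makes the first
-- hit, at target 5; and a trip through vertex 2 reading r^(p) = 2 makes hit
-- number p, at target 4.  Thus UD(r) starts with 2 and has 1 in position p,
-- which equals position q for any other period q; a palindrome of period q has
-- equal first and q-th terms.
module Submission where

open import Defs
open import Data.Nat
open import Data.Nat.Properties
open import Data.Nat.Tactic.RingSolver using (solve-∀)
open import Data.Maybe using (Maybe; just; nothing)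
open import Data.Maybe.Properties using (just-injective)
open import Data.Product using (_×_; _,_; ∃-syntax)
open import Data.Sum using (inj₁; inj₂)
open import Relation.Nullary using (yes; no; contradiction)
open import Relation.Binary using (tri<; tri≈; tri>)
open import Relation.Binary.PropositionalEquality
open import Algebra.Properties.CommutativeSemigroup +-commutativeSemigroup using (interchange)
open ≡-Reasoning

one≢two : one ≢ two
one≢two ()

≢two⇒≡one : ∀ {x} → x ≢ two → x ≡ one
≢two⇒≡one {one} _   = refl
≢two⇒≡one {two} x≢two = contradiction refl x≢two

Periodic : {A : Set} → (ℕ → A) → ℕ → Set
Periodic f p = ∀ k → f (k + p) ≡ f k

module _ {A : Set} {f : ℕ → A} where

  periodic-double : ∀ {p} → Periodic f p → Periodic f (p + p)
  periodic-double {p} per k = begin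
    f (k + (p + p)) ≡⟨ cong f (sym (+-assoc k p p)) ⟩
    f (k + p + p)   ≡⟨ per (k + p) ⟩
    f (k + p)       ≡⟨ per k ⟩
    f k             ∎

  periodic-* : ∀ {p} → Periodic f p → ∀ j k → f (k + j * p) ≡ f k
  periodic-* per zero    k = cong f (+-identityʳ k)
  periodic-* {p} per (suc j) k = begin
    f (k + (p + j * p)) ≡⟨ cong f (trans (cong (k +_) (+-comm p (j * p))) (sym (+-assoc k (j * p) p))) ⟩
    f (k + j * p + p)   ≡⟨ per (k + j * p) ⟩
    f (k + j * p)       ≡⟨ periodic-* per j k ⟩
    f k                 ∎

  periodic-pred-agree : ∀ {m n} → Periodic f (suc m) → Periodic f (suc n) → f m ≡ f n
  periodic-pred-agree {m} {n} per-m per-n = begin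
    f m                 ≡⟨ sym (periodic-* per-m n m) ⟩
    f (m + n * suc m)   ≡⟨ cong f (swap m n) ⟩
    f (n + m * suc n)   ≡⟨ periodic-* per-n m n ⟩
    f n                 ∎
    where
    swap : ∀ m n → m + n * suc m ≡ n + m * suc n
    swap = solve-∀

discrete-ivt : (F : ℕ → ℕ) → (∀ n → F (suc n) ≤ suc (F n)) →
  ∀ n k → F 0 ≤ k → k < F n → ∃[ j ] F j ≡ k × F (suc j) ≡ suc k
discrete-ivt F step zero    k F0≤k k<F0 = contradiction F0≤k (<⇒≱ k<F0)
discrete-ivt F step (suc n) k F0≤k k<F[n+1] with k <? F n
... | yes k<Fn = discrete-ivt F step n k F0≤k k<Fn
... | no  k≮Fn = n , Fn≡k , ≤-antisym (subst (λ m → F (suc n) ≤ suc m) Fn≡k (step n)) k<F[n+1]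
  where
  Fn≡k : F n ≡ k
  Fn≡k = ≤-antisym (≮⇒≥ k≮Fn) (≤-pred (≤-trans k<F[n+1] (step n)))

δ : S → S → ℕ
δ one one = 1
δ one two = 0
δ two one = 0
δ two two = 1

δ-+-≤ : ∀ x y n → δ x y + n ≤ suc n
δ-+-≤ one one n = ≤-refl
δ-+-≤ one two n = n≤1+n n
δ-+-≤ two one n = n≤1+n n
δ-+-≤ two two n = ≤-refl

δ-+-≡suc : ∀ {x y n} → δ x y + n ≡ suc n → y ≡ x
δ-+-≡suc {one} {one} _ = refl
δ-+-≡suc {one} {two} e = contradiction (sym e) 1+n≢n
δ-+-≡suc {two} {one} e = contradiction (sym e) 1+n≢n
δ-+-≡suc {two} {two} _ = refl

count-suc : ∀ x s n → count x s (suc n) ≡ δ x (s n) + count x s n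
count-suc one s n with s n
... | one = refl
... | two = refl
count-suc two s n with s n
... | one = refl
... | two = refl

count-one+two : ∀ s n → count one s n + count two s n ≡ n
count-one+two s zero = refl
count-one+two s (suc n) with s n
... | one = cong suc (count-one+two s n)
... | two = trans (+-suc _ _) (cong suc (count-one+two s n))

count-+-period : ∀ {s p} x → Periodic s p → ∀ n → count x s (n + p) ≡ count x s n + count x s p
count-+-period x per zero = refl
count-+-period {s} {p} x per (suc n) = begin
  count x s (suc (n + p))                       ≡⟨ count-suc x s (n + p) ⟩
  δ x (s (n + p)) + count x s (n + p)           ≡⟨ cong₂ _+_ (cong (δ x) (per n)) (count-+-period x per n) ⟩
  δ x (s n) + (count x s n + count x s p)       ≡⟨ sym (+-assoc (δ x (s n)) _ _) ⟩
  (δ x (s n) + count x s n) + count x s p       ≡⟨ cong (_+ count x s p) (sym (count-suc x s n)) ⟩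
  count x s (suc n) + count x s p               ∎

count-suc-≤ : ∀ x s n → count x s (suc n) ≤ suc (count x s n)
count-suc-≤ x s n = subst (_≤ suc (count x s n)) (sym (count-suc x s n)) (δ-+-≤ x (s n) _)

count-ivt : ∀ {s n k} x → k < count x s n → ∃[ j ] count x s j ≡ k × s j ≡ x
count-ivt {s} {n} {k} x k<count
  with discrete-ivt (count x s) (count-suc-≤ x s) n k z≤n k<count
... | j , cj≡k , cj+1≡suc-k =
  j , cj≡k , δ-+-≡suc (trans (sym (count-suc x s j)) (trans cj+1≡suc-k (cong suc (sym cj≡k))))

addHit : Maybe S → ℕ → ℕ
addHit (just _) n = suc n
addHit nothing  n = n

addHit-≤ : ∀ m n → n ≤ addHit m n
addHit-≤ (just _) n = n≤1+n n
addHit-≤ nothing  n = ≤-refl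

addHit-≤suc : ∀ m n → addHit m n ≤ suc n
addHit-≤suc (just _) n = ≤-refl
addHit-≤suc nothing  n = n≤1+n n

addHit-≡suc : ∀ {m n} → addHit m n ≡ suc n → ∃[ x ] m ≡ just x
addHit-≡suc {just x}  _ = x , refl
addHit-≡suc {nothing} e = contradiction (sym e) 1+n≢n

reached : Config → Maybe S
reached C = label (Config.pos C)

moves : (ℕ → S) → ℕ → Config → Config
moves r zero    C = C
moves r (suc d) C = step r (moves r d C)

tripTarget : S → S → S → Maybe S
tripTarget one one _ = nothing
tripTarget one two _ = just one
tripTarget two _ one = just two
tripTarget two _ two = nothing

module _ (r : ℕ → S) where

  run-+ : ∀ d t → run r (d + t) ≡ moves r d (run r t)
  run-+ zero    t = refl
  run-+ (suc d) t = cong (step r) (run-+ d t)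

  reached-after : ∀ t {C} → run r t ≡ C → ∀ d → reached (run r (d + t)) ≡ reached (moves r d C)
  reached-after t eq d = cong reached (trans (run-+ d t) (cong (moves r d) eq))

  hits-suc : ∀ t → hits r (suc t) ≡ addHit (reached (run r t)) (hits r t)
  hits-suc t with label (Config.pos (run r t))
  ... | just _  = refl
  ... | nothing = refl

  hits-after-hit : ∀ {t t' x} → t < t' → reached (run r t) ≡ just x → hits r t < hits r t'
  hits-after-hit {t} {suc u} t<t' hit with m<1+n⇒m<n∨m≡n t<t'
  ... | inj₂ refl = ≤-reflexive (sym (trans (hits-suc t) (cong (λ m → addHit m (hits r t)) hit)))
  ... | inj₁ t<u  = <-≤-trans (hits-after-hit t<u hit)
                              (subst (hits r u ≤_) (sym (hits-suc u)) (addHit-≤ _ _))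

  hitting-seq-at : ∀ {h x} t → IsHittingSeq r h → reached (run r t) ≡ just x → h (hits r t) ≡ x
  hitting-seq-at {h} t hs hit with hs (hits r t)
  ... | t' , hit' , same with <-cmp t t'
  ...   | tri< t<t' _ _ = contradiction same (≢-sym (<⇒≢ (hits-after-hit t<t' hit)))
  ...   | tri≈ _ refl _ = just-injective (trans (sym hit') hit)
  ...   | tri> _ _ t'<t = contradiction same (<⇒≢ (hits-after-hit t'<t hit'))

  trip-first : ∀ a b c → reached (moves r 1 (cfg v1 a b c)) ≡ nothing
  trip-first a b c with r a
  ... | one = refl
  ... | two = refl

  trip-target : ∀ a b c → reached (moves r 2 (cfg v1 a b c)) ≡ tripTarget (r a) (r b) (r c)
  trip-target a b c with r a
  ... | one with r b
  ...   | one = refl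
  ...   | two = refl
  trip-target a b c | two with r c
  ...   | one = refl
  ...   | two = refl

  -- A trip takes two moves, plus one to return from the target if it hits one.
  trip-end : ∀ a b c → moves r (addHit (tripTarget (r a) (r b) (r c)) 2) (cfg v1 a b c)
                       ≡ cfg v1 (suc a) (δ one (r a) + b) (δ two (r a) + c)
  trip-end a b c with r a in ea
  ... | one with r b in eb
  ...   | one rewrite ea | eb = refl
  ...   | two rewrite ea | eb = refl
  trip-end a b c | two with r c in ec
  ...   | one rewrite ea | ec = refl
  ...   | two rewrite ea | ec = refl

  hits-two-moves : ∀ t {a b c} → run r t ≡ cfg v1 a b c → hits r (2 + t) ≡ hits r t
  hits-two-moves t {a} {b} {c} eq = begin
    hits r (2 + t)
      ≡⟨ hits-suc (1 + t) ⟩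
    addHit (reached (run r (1 + t))) (hits r (1 + t))
      ≡⟨ cong₂ addHit (trans (reached-after t eq 1) (trip-first a b c)) (hits-suc t) ⟩
    addHit (reached (run r t)) (hits r t)
      ≡⟨ cong (λ m → addHit m (hits r t)) (reached-after t eq 0) ⟩
    hits r t
      ∎

  hits-over-trip : ∀ t {a b c} → run r t ≡ cfg v1 a b c →
    let m = tripTarget (r a) (r b) (r c) in hits r (addHit m 2 + t) ≡ addHit m (hits r t)
  hits-over-trip t {a} {b} {c} eq with tripTarget (r a) (r b) (r c) in target
  ... | nothing = hits-two-moves t eq
  ... | just x  = begin
    hits r (3 + t)
      ≡⟨ hits-suc (2 + t) ⟩
    addHit (reached (run r (2 + t))) (hits r (2 + t))
      ≡⟨ cong₂ addHit (trans (reached-after t eq 2) (trans (trip-target a b c) target)) (hits-two-moves t eq) ⟩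
    suc (hits r t)
      ∎

  ones twos : ℕ → ℕ
  ones = count one r
  twos = count two r

  outcome : ℕ → Maybe S
  outcome a = tripTarget (r a) (r (ones a)) (r (twos a))

  tripLength : ℕ → ℕ
  tripLength a = addHit (outcome a) 2

  start : ℕ → ℕ
  start zero    = 0
  start (suc a) = tripLength a + start a

  hitsBefore : ℕ → ℕ
  hitsBefore a = twos (ones a) + ones (twos a)

  hitsBefore-suc : ∀ a → hitsBefore (suc a) ≡ addHit (outcome a) (hitsBefore a)
  hitsBefore-suc a rewrite count-suc one r a | count-suc two r a with r a
  ... | one rewrite count-suc two r (ones a) with r (ones a)
  ...   | one = refl
  ...   | two = refl
  hitsBefore-suc a | two rewrite count-suc one r (twos a) with r (twos a)
  ...   | one = +-suc _ _
  ...   | two = refl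

  hitsBefore-suc-≤ : ∀ a → hitsBefore (suc a) ≤ suc (hitsBefore a)
  hitsBefore-suc-≤ a = subst (_≤ suc (hitsBefore a)) (sym (hitsBefore-suc a)) (addHit-≤suc (outcome a) (hitsBefore a))

  run-start : ∀ a → run r (start a) ≡ cfg v1 a (ones a) (twos a)
  run-start zero    = refl
  run-start (suc a) = begin
    run r (tripLength a + start a)
      ≡⟨ run-+ (tripLength a) (start a) ⟩
    moves r (tripLength a) (run r (start a))
      ≡⟨ cong (moves r (tripLength a)) (run-start a) ⟩
    moves r (tripLength a) (cfg v1 a (ones a) (twos a))
      ≡⟨ trip-end a (ones a) (twos a) ⟩
    cfg v1 (suc a) (δ one (r a) + ones a) (δ two (r a) + twos a)
      ≡⟨ sym (cong₂ (cfg v1 (suc a)) (count-suc one r a) (count-suc two r a)) ⟩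
    cfg v1 (suc a) (ones (suc a)) (twos (suc a))
      ∎

  hits-start : ∀ a → hits r (start a) ≡ hitsBefore a
  hits-start zero    = refl
  hits-start (suc a) = begin
    hits r (start (suc a))                 ≡⟨ hits-over-trip (start a) (run-start a) ⟩
    addHit (outcome a) (hits r (start a))  ≡⟨ cong (addHit (outcome a)) (hits-start a) ⟩
    addHit (outcome a) (hitsBefore a)      ≡⟨ sym (hitsBefore-suc a) ⟩
    hitsBefore (suc a)                     ∎

  hitting-trip : ∀ {h a k x} → IsHittingSeq r h → hitsBefore a ≡ k → outcome a ≡ just x → h k ≡ x
  hitting-trip {h} {a} {k} {x} hs hits≡k out = subst (λ k → h k ≡ x) hits≡
    (hitting-seq-at (2 + start a) hs
      (trans (reached-after (start a) (run-start a) 2) (trans (trip-target a (ones a) (twos a)) out)))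
    where
    hits≡ : hits r (2 + start a) ≡ k
    hits≡ = trans (hits-two-moves (start a) (run-start a)) (trans (hits-start a) hits≡k)

  trip-of-hit : ∀ {k} n → k < hitsBefore n → ∃[ a ] ∃[ x ] hitsBefore a ≡ k × outcome a ≡ just x
  trip-of-hit {k} n k<H
    with discrete-ivt hitsBefore hitsBefore-suc-≤ n k z≤n k<H
  ... | a , Ha≡k , Ha+1≡suc-k
    with addHit-≡suc (trans (sym (hitsBefore-suc a)) (trans Ha+1≡suc-k (cong suc (sym Ha≡k))))
  ...   | x , out = a , x , Ha≡k , out

  head-trip : ∀ {p} → r 0 ≡ one → 0 < p → Balanced r p →
    ∃[ a ] hitsBefore a ≡ 0 × outcome a ≡ just two
  head-trip {p} r0 p>0 bal = trip (count-ivt {n = p} two twos-positive)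
    where
    twos-positive : 0 < twos p
    twos-positive = n≢0⇒n>0 λ twos≡0 → <⇒≢ p>0 (sym (begin
      p               ≡⟨ sym (count-one+two r p) ⟩
      ones p + twos p ≡⟨ cong₂ _+_ (trans bal twos≡0) twos≡0 ⟩
      0               ∎))
    trip : ∃[ m ] twos m ≡ 0 × r m ≡ two → ∃[ a ] hitsBefore a ≡ 0 × outcome a ≡ just two
    trip (m , twos-m≡0 , rm≡two) = m , hits≡0 , out
      where
      ones-m≡m : ones m ≡ m
      ones-m≡m = begin
        ones m          ≡⟨ sym (+-identityʳ (ones m)) ⟩
        ones m + 0      ≡⟨ cong (ones m +_) (sym twos-m≡0) ⟩
        ones m + twos m ≡⟨ count-one+two r m ⟩
        m               ∎
      hits≡0 : hitsBefore m ≡ 0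
      hits≡0 rewrite ones-m≡m | twos-m≡0 = refl
      out : outcome m ≡ just two
      out rewrite rm≡two | twos-m≡0 | r0 = refl

  tail-trip : ∀ {p'} → Periodic r (suc p') → Balanced r (suc p') → r p' ≡ two →
    ∃[ a ] hitsBefore a ≡ p' × outcome a ≡ just one
  tail-trip {p'} per bal rp'≡two = trip (count-ivt {n = suc p'} one (subst (m <_) (sym ones-p) ≤-refl))
    where
    m : ℕ
    m = twos p'
    twos-p : twos (suc p') ≡ suc m
    twos-p = trans (count-suc two r p') (cong (λ y → δ two y + m) rp'≡two)
    ones-p : ones (suc p') ≡ suc m
    ones-p = trans bal twos-p
    trip : ∃[ j ] ones j ≡ m × r j ≡ one → ∃[ a ] hitsBefore a ≡ p' × outcome a ≡ just one
    -- Trip j reads vertex 2's rotor at index m; trip j + p reads it at index m + (m + 1) = p'.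
    trip (j , ones-j , rj≡one) = j + suc p' , hits≡ , out
      where
      half : m + suc m ≡ p'
      half = suc-injective (trans (cong₂ _+_ (sym ones-p) (sym twos-p)) (count-one+two r (suc p')))
      ones-a : ones (j + suc p') ≡ p'
      ones-a = trans (count-+-period one per j) (trans (cong₂ _+_ ones-j ones-p) half)
      twos-a : twos (j + suc p') ≡ suc j
      twos-a = begin
        twos (j + suc p')      ≡⟨ count-+-period two per j ⟩
        twos j + twos (suc p') ≡⟨ cong (twos j +_) twos-p ⟩
        twos j + suc m         ≡⟨ +-suc (twos j) m ⟩
        suc (twos j + m)       ≡⟨ cong (λ k → suc (twos j + k)) (sym ones-j) ⟩
        suc (twos j + ones j)  ≡⟨ cong suc (trans (+-comm (twos j) (ones j)) (count-one+two r j)) ⟩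
        suc j                  ∎
      hits≡ : hitsBefore (j + suc p') ≡ p'
      hits≡ rewrite ones-a | twos-a | count-suc one r j | rj≡one | ones-j = half
      out : outcome (j + suc p') ≡ just one
      out rewrite ones-a | per j | rj≡one | rp'≡two = refl

  module _ {p} (p>0 : 0 < p) (per : Periodic r p) (bal : Balanced r p) where

    count-double-period : ∀ x → count x r (p + p) ≡ p
    count-double-period one =
      trans (count-+-period one per p) (trans (cong (ones p +_) bal) (count-one+two r p))
    count-double-period two =
      trans (count-+-period two per p) (trans (cong (_+ twos p) (sym bal)) (count-one+two r p))

    count-shift : ∀ x a → count x r (a + (p + p)) ≡ count x r a + p
    count-shift x a =
      trans (count-+-period x (periodic-double per) a) (cong (count x r a +_) (count-double-period x))

    outcome-shift : ∀ a → outcome (a + (p + p)) ≡ outcome a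
    outcome-shift a rewrite count-shift one a | count-shift two a
                          | periodic-double per a | per (ones a) | per (twos a) = refl

    hitsBefore-shift : ∀ a → hitsBefore (a + (p + p)) ≡ hitsBefore a + p
    hitsBefore-shift a = begin
      twos (ones (a + (p + p))) + ones (twos (a + (p + p)))
        ≡⟨ cong₂ _+_ (cong twos (count-shift one a)) (cong ones (count-shift two a)) ⟩
      twos (ones a + p) + ones (twos a + p)
        ≡⟨ cong₂ _+_ (count-+-period two per (ones a)) (count-+-period one per (twos a)) ⟩
      (twos (ones a) + twos p) + (ones (twos a) + ones p)
        ≡⟨ interchange (twos (ones a)) (twos p) (ones (twos a)) (ones p) ⟩
      hitsBefore a + (twos p + ones p)
        ≡⟨ cong (hitsBefore a +_) (trans (+-comm (twos p) (ones p)) (count-one+two r p)) ⟩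
      hitsBefore a + p
        ∎

    hitsBefore-unbounded : ∀ k → k ≤ hitsBefore (k * (p + p))
    hitsBefore-unbounded zero    = z≤n
    hitsBefore-unbounded (suc k) =
      subst (suc k ≤_) (sym shift) (subst (_≤ hitsBefore (k * (p + p)) + p) (+-comm k 1) grow)
      where
      grow : k + 1 ≤ hitsBefore (k * (p + p)) + p
      grow = +-mono-≤ (hitsBefore-unbounded k) p>0
      shift : hitsBefore ((p + p) + k * (p + p)) ≡ hitsBefore (k * (p + p)) + p
      shift = trans (cong hitsBefore (+-comm (p + p) _)) (hitsBefore-shift (k * (p + p)))

    hitting-periodic : ∀ {h} → IsHittingSeq r h → Periodic h p
    hitting-periodic {h} hs k with trip-of-hit (suc k * (p + p)) (hitsBefore-unbounded (suc k))
    ... | a , x , Ha≡k , out = trans (hitting-trip hs Ha+p+p≡k+p (trans (outcome-shift a) out))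
                                     (sym (hitting-trip hs Ha≡k out))
      where
      Ha+p+p≡k+p : hitsBefore (a + (p + p)) ≡ k + p
      Ha+p+p≡k+p = trans (hitsBefore-shift a) (cong (_+ p) Ha≡k)

theorem5p7 : (r : ℕ → S) (p : ℕ) → FundPeriod r p → r 0 ≡ one → Balanced r p →
    (h : ℕ → S) (q : ℕ) → IsHittingSeq r h → FundPeriod h q → Palindromic h q →
    r 0 ≡ r (p ∸ 1)
theorem5p7 r zero ((() , _) , _) _ _ _ _ _ _ _
theorem5p7 r (suc p') _ _ _ h zero _ ((() , _) , _) _
theorem5p7 r (suc p') ((p>0 , r-per) , _) r0 bal h (suc q') hs ((q>0 , h-per) , _) pal =
  trans r0 (sym (≢two⇒≡one last≢two))
  where
  last≢two : r p' ≢ two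
  last≢two last with head-trip r r0 p>0 bal | tail-trip r r-per bal last
  ... | _ , hits≡0 , head-out | _ , hits≡p' , tail-out = one≢two (begin
    one   ≡⟨ sym (hitting-trip r hs hits≡p' tail-out) ⟩
    h p'  ≡⟨ periodic-pred-agree (hitting-periodic r p>0 r-per bal hs) h-per ⟩
    h q'  ≡⟨ sym (pal 0 q>0) ⟩
    h 0   ≡⟨ hitting-trip r hs hits≡0 head-out ⟩
    two   ∎)
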